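{- Let $\mathcal E$ be a finitely complete category equipped with a cloven weak factorisation system which is functorially Frobenius and has a stable functorial choice of diagonal factorisations (that is, $\mathcal E$ is a homotopy-theoretic model of identity types). Then the type category with category of contexts $\mathcal E$, whose types over $\Gamma$ are the cloven $\mathcal R$-maps with codomain $\Gamma$ (with $\Gamma.A$ the domain of the map, $\pi_A$ the map itself, and substitution given by pullback equipped with the induced cloven $\mathcal R$-map structure), carries strong identity types; i.e. $\mathcal E$ is a categorical model of identity types.
   Context: A cloven weak factorisation system (cloven w.f.s.) on a category $\mathcal E$ consists of: for each $f\colon X\to Y$ a factorisation $f=\rho_f\lambda_f$ with $\lambda_f\colon X\to Pf$, $\rho_f\colon Pf\to Y$; for each commutative square $gh=kf$ (with $f\colon U\to V$, $g\colon X\to Y$, $h\colon U\to X$, $k\colon V\to Y$) a map $P(h,k)\colon Pf\to Pg$ with $P(h,k)\lambda_f=\lambda_g h$ and $\rho_g P(h,k)=k\rho_f$, functorial in $(h,k)$; and for each $f$ maps $\sigma_f\colon Pf\to P\lambda_f$ with $\sigma_f\lambda_f=\lambda_{\lambda_f}$, $\rho_{\lambda_f}\sigma_f=1$, and $\pi_f\colon P\rho_f\to Pf$ with $\pi_f\lambda_{\rho_f}=1$, $\rho_f\pi_f=\rho_{\rho_f}$. A cloven $\mathcal L$-map $(f,s)$ is $f\colon X\to Y$ with $s\colon Y\to Pf$, $sf=\lambda_f$, $\rho_f s=1_Y$; a cloven $\mathcal R$-map $(f,p)$ is $f\colon X\to Y$ with $p\colon Pf\to X$, $p\lambda_f=1_X$,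 $fp=\rho_f$. A morphism of cloven $\mathcal L$-maps $(f,s)\to(g,t)$ is a commutative square $(h,k)$ from $f$ to $g$ with $P(h,k)s=tk$; a morphism of cloven $\mathcal R$-maps $(f,p)\to(g,q)$ is a commutative square $(h,k)$ with $qP(h,k)=hp$. These form categories $\mathcal L\text{ -Map}$, $\mathcal R\text{ -Map}$, with forgetful functors to the arrow category. A choice of diagonal factorisations assigns to each cloven $\mathcal R$-map $(x,p)\colon X\to\Gamma$ a factorisation $X\xrightarrow{i_x}I(x)\xrightarrow{j_x}X\times_\Gamma X$ of the diagonal, with a cloven $\mathcal L$-map structure on $i_x$ and a cloven $\mathcal R$-map structure on $j_x$. It is functorial if for each morphism of cloven $\mathcal R$-maps $(f,g)\colon(x,p)\to(y,q)$ there is $I(f,g)\colon I(x)\to I(y)$, functorially, such that $(f,I(f,g))$ is a morphism of cloven $\mathcal L$-maps $i_x\to i_y$ and $(I(f,g),f\times_g f)$ is a morphism of cloven $\mathcal R$-maps $j_x\to j_y$. It is stable if whenever the square underlying $(f,g)$ is a pullback, so is the square $(I(f,g),f\times_gf)$ from $j_x$ to $j_y$. The cloven w.f.s. is functorially Frobenius if for every pullback $\bar\imath\colon f^*X\to B$ of a cloven $\mathcal L$-map $i\colon X\to A$ along a cloven $\mathcal R$-map $f\colon B\to A$ there is assigned a cloven $\mathcal L$-map structure on $\bar\imath$, functorially, i.e. giving a functor $\mathcal R\text{ -Map}\times_{\mathcal E}\mathcal L\text{ -Map}\to\mathcal L\text{ -Map}$. A type category consists of a category $\mathcal C$; for each $\Gamma$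 a collection $\mathrm{Ty}(\Gamma)$; for $A\in\mathrm{Ty}(\Gamma)$ an object $\Gamma.A$ and $\pi_A\colon\Gamma.A\to\Gamma$; for $f\colon\Delta\to\Gamma$ a type $A[f]\in\mathrm{Ty}(\Delta)$ and $f^+\colon\Delta.A[f]\to\Gamma.A$ such that $\pi_Af^+=f\pi_{A[f]}$ is a pullback square (no strict functoriality of substitution is required). For $A,B\in\mathrm{Ty}(\Gamma)$ write $B^+=B[\pi_A]$ and $\delta_A\colon\Gamma.A\to\Gamma.A.A^+$ for the diagonal. Strong identity types consist of $\mathrm{Id}_A\in\mathrm{Ty}(\Gamma.A.A^+)$ and $r_A\colon\Gamma.A\to\Gamma.A.A^+.\mathrm{Id}_A$ with $\pi_{\mathrm{Id}_A}r_A=\delta_A$, and, for every finite sequence of iterated types $B_1\in\mathrm{Ty}(\Gamma.A.A^+.\mathrm{Id}_A)$, \dots, $B_n$ (abbreviated $\Delta$), every $C\in\mathrm{Ty}(\Gamma.A.A^+.\mathrm{Id}_A.\Delta)$ and every $d\colon\Gamma.A.\Delta[r_A]\to\Gamma.A.A^+.\mathrm{Id}_A.\Delta.C$ with $\pi_Cd=(r_A)^{+\cdots+}$ (the map induced by $r_A$ on the pulled-back extensions), a map $J$ with $J(r_A)^{+\cdots+}=d$ and $\pi_CJ=1$; all of this stable under substitution along any $f\colon\Delta'\to\Gamma$ (the identity type and $r$ commute with the induced maps $f^{+},f^{++},f^{+++}$, and the chosen fillers for the substituted data are the substitutions of the chosen fillers). A categorical model of identity types is a type category with strong identity types. -}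

module Defs where

open import Level using (Level; _⊔_) renaming (suc to lsuc)
open import Relation.Binary.PropositionalEquality using (_≡_; refl; sym; trans; cong; module ≡-Reasoning)
open import Data.Product using (Σ; _,_; proj₁; proj₂; _×_; Σ-syntax)

record Category (o ℓ : Level) : Set (lsuc (o ⊔ ℓ)) where
  infixr 9 _∘_
  field
    Obj : Set o
    Hom : Obj → Obj → Set ℓ
    id  : ∀ {X} → Hom X X
    _∘_ : ∀ {X Y Z} → Hom Y Z → Hom X Y → Hom X Z
    identityˡ : ∀ {X Y} {f : Hom X Y} → id ∘ f ≡ f
    identityʳ : ∀ {X Y} {f : Hom X Y} → f ∘ id ≡ f
    assoc : ∀ {W X Y Z} {f : Hom Y Z} {g : Hom X Y} {h : Hom W X} →
            (f ∘ g) ∘ h ≡ f ∘ (g ∘ h)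
    Hom-isSet : ∀ {X Y} {f g : Hom X Y} (p q : f ≡ g) → p ≡ q

module _ {o ℓ : Level} (𝒞 : Category o ℓ) where
  open Category 𝒞
  open ≡-Reasoning

  IsPullback : ∀ {P A B C} (f : Hom A C) (g : Hom B C) (p : Hom P A) (q : Hom P B) → Set (o ⊔ ℓ)
  IsPullback {P} {A} {B} f g p q =
    ∀ {V} (a : Hom V A) (b : Hom V B) → f ∘ a ≡ g ∘ b →
    Σ[ u ∈ Hom V P ] ((p ∘ u ≡ a) × (q ∘ u ≡ b) ×
                      (∀ (u' : Hom V P) → p ∘ u' ≡ a → q ∘ u' ≡ b → u' ≡ u))

  record Pullback {A B C : Obj} (f : Hom A C) (g : Hom B C) : Set (o ⊔ ℓ) where
    field
      apex : Obj
      p₁ : Hom apex A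
      p₂ : Hom apex B
      commute : f ∘ p₁ ≡ g ∘ p₂
      isPullback : IsPullback f g p₁ p₂

  IsTerminal : Obj → Set (o ⊔ ℓ)
  IsTerminal T = ∀ X → Σ[ u ∈ Hom X T ] (∀ (v : Hom X T) → v ≡ u)

  record FinitelyComplete : Set (o ⊔ ℓ) where
    field
      terminal : Obj
      terminal-isTerminal : IsTerminal terminal
      pullback : ∀ {A B C} (f : Hom A C) (g : Hom B C) → Pullback f g

  record ClovenWFS : Set (o ⊔ ℓ) where
    field
      P   : ∀ {X Y} → Hom X Y → Obj
      lam : ∀ {X Y} (f : Hom X Y) → Hom X (P f)
      ρ   : ∀ {X Y} (f : Hom X Y) → Hom (P f) Y
      factorises : ∀ {X Y} (f : Hom X Y) → ρ f ∘ lam f ≡ f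
      Pmap : ∀ {U V X Y} (f : Hom U V) (g : Hom X Y) (h : Hom U X) (k : Hom V Y) →
             g ∘ h ≡ k ∘ f → Hom (P f) (P g)
      Pmap-lam : ∀ {U V X Y} (f : Hom U V) (g : Hom X Y) (h : Hom U X) (k : Hom V Y)
                 (e : g ∘ h ≡ k ∘ f) → Pmap f g h k e ∘ lam f ≡ lam g ∘ h
      Pmap-ρ : ∀ {U V X Y} (f : Hom U V) (g : Hom X Y) (h : Hom U X) (k : Hom V Y)
               (e : g ∘ h ≡ k ∘ f) → ρ g ∘ Pmap f g h k e ≡ k ∘ ρ f
      Pmap-id : ∀ {U V} (f : Hom U V) (e : f ∘ id ≡ id ∘ f) → Pmap f f id id e ≡ id
      Pmap-∘ : ∀ {U V X Y X' Y'} (f : Hom U V) (g : Hom X Y) (g' : Hom X' Y')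
               (h : Hom U X) (k : Hom V Y) (h' : Hom X X') (k' : Hom Y Y')
               (e : g ∘ h ≡ k ∘ f) (e' : g' ∘ h' ≡ k' ∘ g)
               (e'' : g' ∘ (h' ∘ h) ≡ (k' ∘ k) ∘ f) →
               Pmap f g' (h' ∘ h) (k' ∘ k) e'' ≡ Pmap g g' h' k' e' ∘ Pmap f g h k e
      sigma : ∀ {X Y} (f : Hom X Y) → Hom (P f) (P (lam f))
      sigma-lam : ∀ {X Y} (f : Hom X Y) → sigma f ∘ lam f ≡ lam (lam f)
      sigma-ρ : ∀ {X Y} (f : Hom X Y) → ρ (lam f) ∘ sigma f ≡ id
      pi : ∀ {X Y} (f : Hom X Y) → Hom (P (ρ f)) (P f)
      pi-lam : ∀ {X Y} (f : Hom X Y) → pi f ∘ lam (ρ f) ≡ id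
      pi-ρ : ∀ {X Y} (f : Hom X Y) → ρ f ∘ pi f ≡ ρ (ρ f)

  module _ (W : ClovenWFS) where
    open ClovenWFS W

    record LStr {X Y : Obj} (f : Hom X Y) : Set ℓ where
      field
        s : Hom Y (P f)
        s-f : s ∘ f ≡ lam f
        ρ-s : ρ f ∘ s ≡ id

    record RStr {X Y : Obj} (f : Hom X Y) : Set ℓ where
      field
        p : Hom (P f) X
        p-lam : p ∘ lam f ≡ id
        f-p : f ∘ p ≡ ρ f

    IsLMor : ∀ {U V X Y} {f : Hom U V} {g : Hom X Y} → LStr f → LStr g →
             (h : Hom U X) (k : Hom V Y) → g ∘ h ≡ k ∘ f → Set ℓ
    IsLMor {f = f} {g} s t h k e = Pmap f g h k e ∘ LStr.s s ≡ LStr.s t ∘ k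

    IsRMor : ∀ {U V X Y} {f : Hom U V} {g : Hom X Y} → RStr f → RStr g →
             (h : Hom U X) (k : Hom V Y) → g ∘ h ≡ k ∘ f → Set ℓ
    IsRMor {f = f} {g} p q h k e = RStr.p q ∘ Pmap f g h k e ≡ h ∘ RStr.p p

    -- Functorial Frobenius structure: for a cloven R-map f : B → A and a
    -- cloven L-map i : X → A, a pullback of i along f whose projection
    -- ī : f*X → B carries a cloven L-map structure, functorially in
    -- R-Map ×_E L-Map (morphisms go to the induced squares).

    record FunctoriallyFrobenius : Set (o ⊔ ℓ) where
      field
        pb : ∀ {X B A} (f : Hom B A) (pf : RStr f) (i : Hom X A) (si : LStr i) → Pullback i f
        frob : ∀ {X B A} (f : Hom B A) (pf : RStr f) (i : Hom X A) (si : LStr i) →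
               LStr (Pullback.p₂ (pb f pf i si))
        frob-mor : ∀ {X B A X' B' A'} (f : Hom B A) (pf : RStr f) (i : Hom X A) (si : LStr i)
                   (f' : Hom B' A') (pf' : RStr f') (i' : Hom X' A') (si' : LStr i')
                   (a : Hom B B') (b : Hom X X') (c : Hom A A')
                   (ea : f' ∘ a ≡ c ∘ f) → IsRMor pf pf' a c ea →
                   (eb : i' ∘ b ≡ c ∘ i) → IsLMor si si' b c eb →
                   (m : Hom (Pullback.apex (pb f pf i si)) (Pullback.apex (pb f' pf' i' si')))
                   (m₁ : Pullback.p₁ (pb f' pf' i' si') ∘ m ≡ b ∘ Pullback.p₁ (pb f pf i si))
                   (m₂ : Pullback.p₂ (pb f' pf' i' si') ∘ m ≡ a ∘ Pullback.p₂ (pb f pf i si)) →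
                   IsLMor (frob f pf i si) (frob f' pf' i' si') m a m₂

    module _ (fc : FinitelyComplete) where
      open FinitelyComplete fc

      Kern : ∀ {X Γ} (x : Hom X Γ) → Obj
      Kern x = Pullback.apex (pullback x x)

      diag : ∀ {X Γ} (x : Hom X Γ) → Hom X (Kern x)
      diag x = proj₁ (Pullback.isPullback (pullback x x) id id refl)

      kernMap : ∀ {X Γ Y Δ} (x : Hom X Γ) (y : Hom Y Δ) (f : Hom X Y) (g : Hom Γ Δ) →
                y ∘ f ≡ g ∘ x → Hom (Kern x) (Kern y)
      kernMap x y f g e =
        proj₁ (Pullback.isPullback (pullback y y) (f ∘ PX.p₁) (f ∘ PX.p₂) eq)
        where
          module PX = Pullback (pullback x x)
          eq : y ∘ (f ∘ PX.p₁) ≡ y ∘ (f ∘ PX.p₂)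
          eq = begin
            y ∘ (f ∘ PX.p₁)   ≡⟨ sym assoc ⟩
            (y ∘ f) ∘ PX.p₁   ≡⟨ cong (_∘ PX.p₁) e ⟩
            (g ∘ x) ∘ PX.p₁   ≡⟨ assoc ⟩
            g ∘ (x ∘ PX.p₁)   ≡⟨ cong (g ∘_) PX.commute ⟩
            g ∘ (x ∘ PX.p₂)   ≡⟨ sym assoc ⟩
            (g ∘ x) ∘ PX.p₂   ≡⟨ cong (_∘ PX.p₂) (sym e) ⟩
            (y ∘ f) ∘ PX.p₂   ≡⟨ assoc ⟩
            y ∘ (f ∘ PX.p₂)   ∎

      record StableFunctorialDiagonals : Set (o ⊔ ℓ) where
        field
          I : ∀ {X Γ} (x : Hom X Γ) → RStr x → Obj
          i : ∀ {X Γ} (x : Hom X Γ) (p : RStr x) → Hom X (I x p)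
          j : ∀ {X Γ} (x : Hom X Γ) (p : RStr x) → Hom (I x p) (Kern x)
          factors : ∀ {X Γ} (x : Hom X Γ) (p : RStr x) → j x p ∘ i x p ≡ diag x
          iL : ∀ {X Γ} (x : Hom X Γ) (p : RStr x) → LStr (i x p)
          jR : ∀ {X Γ} (x : Hom X Γ) (p : RStr x) → RStr (j x p)
          Imap : ∀ {X Γ Y Δ} (x : Hom X Γ) (p : RStr x) (y : Hom Y Δ) (q : RStr y)
                 (f : Hom X Y) (g : Hom Γ Δ) (e : y ∘ f ≡ g ∘ x) → IsRMor p q f g e →
                 Hom (I x p) (I y q)
          Imap-id : ∀ {X Γ} (x : Hom X Γ) (p : RStr x) (e : x ∘ id ≡ id ∘ x) (m : IsRMor p p id id e) →
                    Imap x p x p id id e m ≡ id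
          Imap-∘ : ∀ {X Γ Y Δ Z Θ} (x : Hom X Γ) (p : RStr x) (y : Hom Y Δ) (q : RStr y)
                   (z : Hom Z Θ) (r : RStr z)
                   (f : Hom X Y) (g : Hom Γ Δ) (e : y ∘ f ≡ g ∘ x) (m : IsRMor p q f g e)
                   (f' : Hom Y Z) (g' : Hom Δ Θ) (e' : z ∘ f' ≡ g' ∘ y) (m' : IsRMor q r f' g' e')
                   (e'' : z ∘ (f' ∘ f) ≡ (g' ∘ g) ∘ x) (m'' : IsRMor p r (f' ∘ f) (g' ∘ g) e'') →
                   Imap x p z r (f' ∘ f) (g' ∘ g) e'' m'' ≡ Imap y q z r f' g' e' m' ∘ Imap x p y q f g e m
          Imap-sqL : ∀ {X Γ Y Δ} (x : Hom X Γ) (p : RStr x) (y : Hom Y Δ) (q : RStr y)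
                     (f : Hom X Y) (g : Hom Γ Δ) (e : y ∘ f ≡ g ∘ x) (m : IsRMor p q f g e) →
                     i y q ∘ f ≡ Imap x p y q f g e m ∘ i x p
          Imap-L : ∀ {X Γ Y Δ} (x : Hom X Γ) (p : RStr x) (y : Hom Y Δ) (q : RStr y)
                   (f : Hom X Y) (g : Hom Γ Δ) (e : y ∘ f ≡ g ∘ x) (m : IsRMor p q f g e) →
                   IsLMor (iL x p) (iL y q) f (Imap x p y q f g e m) (Imap-sqL x p y q f g e m)
          Imap-sqR : ∀ {X Γ Y Δ} (x : Hom X Γ) (p : RStr x) (y : Hom Y Δ) (q : RStr y)
                     (f : Hom X Y) (g : Hom Γ Δ) (e : y ∘ f ≡ g ∘ x) (m : IsRMor p q f g e) →
                     j y q ∘ Imap x p y q f g e m ≡ kernMap x y f g e ∘ j x p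
          Imap-R : ∀ {X Γ Y Δ} (x : Hom X Γ) (p : RStr x) (y : Hom Y Δ) (q : RStr y)
                   (f : Hom X Y) (g : Hom Γ Δ) (e : y ∘ f ≡ g ∘ x) (m : IsRMor p q f g e) →
                   IsRMor (jR x p) (jR y q) (Imap x p y q f g e m) (kernMap x y f g e)
                          (Imap-sqR x p y q f g e m)
          stable : ∀ {X Γ Y Δ} (x : Hom X Γ) (p : RStr x) (y : Hom Y Δ) (q : RStr y)
                   (f : Hom X Y) (g : Hom Γ Δ) (e : y ∘ f ≡ g ∘ x) (m : IsRMor p q f g e) →
                   IsPullback y g f x →
                   IsPullback (j y q) (kernMap x y f g e) (Imap x p y q f g e m) (j x p)

  -- Type categories (no strict functoriality of substitution)

  record TypeCat (t : Level) : Set (o ⊔ ℓ ⊔ lsuc t) where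
    infixl 20 _[_]
    field
      Ty  : Obj → Set t
      ext : ∀ {Γ} → Ty Γ → Obj
      π   : ∀ {Γ} (A : Ty Γ) → Hom (ext A) Γ
      _[_] : ∀ {Γ Δ} → Ty Γ → Hom Δ Γ → Ty Δ
      q   : ∀ {Γ Δ} (f : Hom Δ Γ) (A : Ty Γ) → Hom (ext (A [ f ])) (ext A)
      q-comm : ∀ {Γ Δ} (f : Hom Δ Γ) (A : Ty Γ) → π A ∘ q f A ≡ f ∘ π (A [ f ])
      q-pb : ∀ {Γ Δ} (f : Hom Δ Γ) (A : Ty Γ) → IsPullback (π A) f (q f A) (π (A [ f ]))

  module _ {t : Level} (T : TypeCat t) where
    open TypeCat T

    data Tele : Obj → Set (o ⊔ t) where
      []  : ∀ {Γ} → Tele Γ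
      _∷_ : ∀ {Γ} (B : Ty Γ) → Tele (ext B) → Tele Γ

    ctx : ∀ {Γ} → Tele Γ → Obj
    ctx {Γ} [] = Γ
    ctx (B ∷ Θ) = ctx Θ

    projT : ∀ {Γ} (Θ : Tele Γ) → Hom (ctx Θ) Γ
    projT [] = id
    projT (B ∷ Θ) = π B ∘ projT Θ

    substT : ∀ {Γ Δ} → Hom Δ Γ → Tele Γ → Tele Δ
    substT σ [] = []
    substT σ (B ∷ Θ) = (B [ σ ]) ∷ substT (q σ B) Θ

    liftT : ∀ {Γ Δ} (σ : Hom Δ Γ) (Θ : Tele Γ) → Hom (ctx (substT σ Θ)) (ctx Θ)
    liftT σ [] = σ
    liftT σ (B ∷ Θ) = liftT (q σ B) Θ

    liftT-proj : ∀ {Γ Δ} (σ : Hom Δ Γ) (Θ : Tele Γ) →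
                 projT Θ ∘ liftT σ Θ ≡ σ ∘ projT (substT σ Θ)
    liftT-proj σ [] = trans identityˡ (sym identityʳ)
    liftT-proj σ (B ∷ Θ) = begin
      (π B ∘ projT Θ) ∘ liftT (q σ B) Θ            ≡⟨ assoc ⟩
      π B ∘ (projT Θ ∘ liftT (q σ B) Θ)            ≡⟨ cong (π B ∘_) (liftT-proj (q σ B) Θ) ⟩
      π B ∘ (q σ B ∘ projT (substT (q σ B) Θ))     ≡⟨ sym assoc ⟩
      (π B ∘ q σ B) ∘ projT (substT (q σ B) Θ)     ≡⟨ cong (_∘ projT (substT (q σ B) Θ)) (q-comm σ B) ⟩
      (σ ∘ π (B [ σ ])) ∘ projT (substT (q σ B) Θ) ≡⟨ assoc ⟩
      σ ∘ (π (B [ σ ]) ∘ projT (substT (q σ B) Θ)) ∎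

    -- the map into Θ[c] induced by x and y (ctx (Θ[c]) is a pullback of projT Θ along c)
    pairT : ∀ {Z W V} (c : Hom W Z) (Θ : Tele Z) (x : Hom V W) (y : Hom V (ctx Θ)) →
            projT Θ ∘ y ≡ c ∘ x → Hom V (ctx (substT c Θ))
    pairT c [] x y e = x
    pairT c (B ∷ Θ) x y e =
      pairT (q c B) Θ (proj₁ (q-pb c B (projT Θ ∘ y) x (trans (sym assoc) e))) y
            (sym (proj₁ (proj₂ (q-pb c B (projT Θ ∘ y) x (trans (sym assoc) e)))))

    pairT-lift : ∀ {Z W V} (c : Hom W Z) (Θ : Tele Z) (x : Hom V W) (y : Hom V (ctx Θ)) →
                 (e : projT Θ ∘ y ≡ c ∘ x) → liftT c Θ ∘ pairT c Θ x y e ≡ y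
    pairT-lift c [] x y e = trans (sym e) identityˡ
    pairT-lift c (B ∷ Θ) x y e =
      pairT-lift (q c B) Θ (proj₁ (q-pb c B (projT Θ ∘ y) x (trans (sym assoc) e))) y
            (sym (proj₁ (proj₂ (q-pb c B (projT Θ ∘ y) x (trans (sym assoc) e)))))

    _⁺ : ∀ {Γ} (A : Ty Γ) → Ty (ext A)
    A ⁺ = A [ π A ]

    δ : ∀ {Γ} (A : Ty Γ) → Hom (ext A) (ext (A ⁺))
    δ A = proj₁ (q-pb (π A) A id id refl)

    f⁺⁺ : ∀ {Γ Δ} (f : Hom Δ Γ) (A : Ty Γ) → Hom (ext ((A [ f ]) ⁺)) (ext (A ⁺))
    f⁺⁺ f A = proj₁ (q-pb (π A) A (q f A ∘ q (π (A [ f ])) (A [ f ])) (q f A ∘ π ((A [ f ]) ⁺)) eq)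
      where
        eq : π A ∘ (q f A ∘ q (π (A [ f ])) (A [ f ])) ≡ π A ∘ (q f A ∘ π ((A [ f ]) ⁺))
        eq = begin
          π A ∘ (q f A ∘ q (π (A [ f ])) (A [ f ]))          ≡⟨ sym assoc ⟩
          (π A ∘ q f A) ∘ q (π (A [ f ])) (A [ f ])          ≡⟨ cong (_∘ q (π (A [ f ])) (A [ f ])) (q-comm f A) ⟩
          (f ∘ π (A [ f ])) ∘ q (π (A [ f ])) (A [ f ])      ≡⟨ assoc ⟩
          f ∘ (π (A [ f ]) ∘ q (π (A [ f ])) (A [ f ]))      ≡⟨ cong (f ∘_) (q-comm (π (A [ f ])) (A [ f ])) ⟩
          f ∘ (π (A [ f ]) ∘ π ((A [ f ]) ⁺))                ≡⟨ sym assoc ⟩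
          (f ∘ π (A [ f ])) ∘ π ((A [ f ]) ⁺)                ≡⟨ cong (_∘ π ((A [ f ]) ⁺)) (sym (q-comm f A)) ⟩
          (π A ∘ q f A) ∘ π ((A [ f ]) ⁺)                    ≡⟨ assoc ⟩
          π A ∘ (q f A ∘ π ((A [ f ]) ⁺))                    ∎

    record IdData : Set (o ⊔ ℓ ⊔ t) where
      field
        Id  : ∀ {Γ} (A : Ty Γ) → Ty (ext (A ⁺))
        r   : ∀ {Γ} (A : Ty Γ) → Hom (ext A) (ext (Id A))
        r-π : ∀ {Γ} (A : Ty Γ) → π (Id A) ∘ r A ≡ δ A
        J   : ∀ {Γ} (A : Ty Γ) (Θ : Tele (ext (Id A))) (C : Ty (ctx Θ))
              (d : Hom (ctx (substT (r A) Θ)) (ext C)) → π C ∘ d ≡ liftT (r A) Θ →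
              Hom (ctx Θ) (ext C)
        J-β : ∀ {Γ} (A : Ty Γ) (Θ : Tele (ext (Id A))) (C : Ty (ctx Θ))
              (d : Hom (ctx (substT (r A) Θ)) (ext C)) (e : π C ∘ d ≡ liftT (r A) Θ) →
              J A Θ C d e ∘ liftT (r A) Θ ≡ d
        J-sec : ∀ {Γ} (A : Ty Γ) (Θ : Tele (ext (Id A))) (C : Ty (ctx Θ))
                (d : Hom (ctx (substT (r A) Θ)) (ext C)) (e : π C ∘ d ≡ liftT (r A) Θ) →
                π C ∘ J A Θ C d e ≡ id
        f⁺⁺⁺ : ∀ {Γ Δ} (f : Hom Δ Γ) (A : Ty Γ) → Hom (ext (Id (A [ f ]))) (ext (Id A))
        f⁺⁺⁺-comm : ∀ {Γ Δ} (f : Hom Δ Γ) (A : Ty Γ) →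
                    π (Id A) ∘ f⁺⁺⁺ f A ≡ f⁺⁺ f A ∘ π (Id (A [ f ]))
        f⁺⁺⁺-pb : ∀ {Γ Δ} (f : Hom Δ Γ) (A : Ty Γ) →
                  IsPullback (π (Id A)) (f⁺⁺ f A) (f⁺⁺⁺ f A) (π (Id (A [ f ])))
        r-stable : ∀ {Γ Δ} (f : Hom Δ Γ) (A : Ty Γ) → f⁺⁺⁺ f A ∘ r (A [ f ]) ≡ r A ∘ q f A

    module _ (D : IdData) where
      open IdData D

      compT : ∀ {Γ Δ} (f : Hom Δ Γ) (A : Ty Γ) (Θ : Tele (ext (Id A))) →
              Hom (ctx (substT (r (A [ f ])) (substT (f⁺⁺⁺ f A) Θ))) (ctx (substT (r A) Θ))
      compT f A Θ = pairT (r A) Θ (q f A ∘ projT Θgr) (liftT g Θ ∘ liftT r' Θg) eqc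
        where
          g  = f⁺⁺⁺ f A
          r' = r (A [ f ])
          Θg = substT g Θ
          Θgr = substT r' Θg
          eqc : projT Θ ∘ (liftT g Θ ∘ liftT r' Θg) ≡ r A ∘ (q f A ∘ projT Θgr)
          eqc = begin
            projT Θ ∘ (liftT g Θ ∘ liftT r' Θg)   ≡⟨ sym assoc ⟩
            (projT Θ ∘ liftT g Θ) ∘ liftT r' Θg   ≡⟨ cong (_∘ liftT r' Θg) (liftT-proj g Θ) ⟩
            (g ∘ projT Θg) ∘ liftT r' Θg          ≡⟨ assoc ⟩
            g ∘ (projT Θg ∘ liftT r' Θg)          ≡⟨ cong (g ∘_) (liftT-proj r' Θg) ⟩
            g ∘ (r' ∘ projT Θgr)                  ≡⟨ sym assoc ⟩
            (g ∘ r') ∘ projT Θgr                  ≡⟨ cong (_∘ projT Θgr) (r-stable f A) ⟩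
            (r A ∘ q f A) ∘ projT Θgr             ≡⟨ assoc ⟩
            r A ∘ (q f A ∘ projT Θgr)             ∎

      compT-lift : ∀ {Γ Δ} (f : Hom Δ Γ) (A : Ty Γ) (Θ : Tele (ext (Id A))) →
                   liftT (r A) Θ ∘ compT f A Θ ≡ liftT (f⁺⁺⁺ f A) Θ ∘ liftT (r (A [ f ])) (substT (f⁺⁺⁺ f A) Θ)
      compT-lift f A Θ = pairT-lift (r A) Θ _ _ _

      dsubU : ∀ {Γ Δ} (f : Hom Δ Γ) (A : Ty Γ) (Θ : Tele (ext (Id A))) (C : Ty (ctx Θ))
              (d : Hom (ctx (substT (r A) Θ)) (ext C)) (e : π C ∘ d ≡ liftT (r A) Θ) → _
      dsubU f A Θ C d e =
        q-pb (liftT (f⁺⁺⁺ f A) Θ) C (d ∘ compT f A Θ) (liftT (r (A [ f ])) (substT (f⁺⁺⁺ f A) Θ))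
          (begin
            π C ∘ (d ∘ compT f A Θ)       ≡⟨ sym assoc ⟩
            (π C ∘ d) ∘ compT f A Θ       ≡⟨ cong (_∘ compT f A Θ) e ⟩
            liftT (r A) Θ ∘ compT f A Θ   ≡⟨ compT-lift f A Θ ⟩
            liftT (f⁺⁺⁺ f A) Θ ∘ liftT (r (A [ f ])) (substT (f⁺⁺⁺ f A) Θ) ∎)

      dsub : ∀ {Γ Δ} (f : Hom Δ Γ) (A : Ty Γ) (Θ : Tele (ext (Id A))) (C : Ty (ctx Θ))
             (d : Hom (ctx (substT (r A) Θ)) (ext C)) (e : π C ∘ d ≡ liftT (r A) Θ) →
             Hom (ctx (substT (r (A [ f ])) (substT (f⁺⁺⁺ f A) Θ))) (ext (C [ liftT (f⁺⁺⁺ f A) Θ ]))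
      dsub f A Θ C d e = proj₁ (dsubU f A Θ C d e)

      dsub-π : ∀ {Γ Δ} (f : Hom Δ Γ) (A : Ty Γ) (Θ : Tele (ext (Id A))) (C : Ty (ctx Θ))
               (d : Hom (ctx (substT (r A) Θ)) (ext C)) (e : π C ∘ d ≡ liftT (r A) Θ) →
               π (C [ liftT (f⁺⁺⁺ f A) Θ ]) ∘ dsub f A Θ C d e ≡ liftT (r (A [ f ])) (substT (f⁺⁺⁺ f A) Θ)
      dsub-π f A Θ C d e = proj₁ (proj₂ (proj₂ (dsubU f A Θ C d e)))

      JStable : Set (o ⊔ ℓ ⊔ t)
      JStable = ∀ {Γ Δ} (f : Hom Δ Γ) (A : Ty Γ) (Θ : Tele (ext (Id A))) (C : Ty (ctx Θ))
                (d : Hom (ctx (substT (r A) Θ)) (ext C)) (e : π C ∘ d ≡ liftT (r A) Θ) →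
                q (liftT (f⁺⁺⁺ f A) Θ) C
                  ∘ J (A [ f ]) (substT (f⁺⁺⁺ f A) Θ) (C [ liftT (f⁺⁺⁺ f A) Θ ])
                      (dsub f A Θ C d e) (dsub-π f A Θ C d e)
                ≡ J A Θ C d e ∘ liftT (f⁺⁺⁺ f A) Θ

    record StrongIdTypes : Set (o ⊔ ℓ ⊔ t) where
      field
        idData : IdData
        J-stable : JStable idData

  module _ (fc : FinitelyComplete) (W : ClovenWFS) where
    open FinitelyComplete fc
    open ClovenWFS W

    record RType (Γ : Obj) : Set (o ⊔ ℓ) where
      constructor rtype
      field
        dom : Obj
        map : Hom dom Γ
        str : RStr W map

    pullbackRStr : ∀ {X Γ Δ} (x : Hom X Γ) (px : RStr W x) (f : Hom Δ Γ) →
                   RStr W (Pullback.p₂ (pullback x f))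
    pullbackRStr {X} {Γ} {Δ} x px f = record { p = p' ; p-lam = p'-lam ; f-p = proj₁ (proj₂ (proj₂ U)) }
      where
        open Pullback (pullback x f)
        open RStr px using () renaming (p to px-p; p-lam to px-lam; f-p to px-fp)
        Pm : Hom (P p₂) (P x)
        Pm = Pmap p₂ x p₁ f commute
        eqU : x ∘ (px-p ∘ Pm) ≡ f ∘ ρ p₂
        eqU = begin
          x ∘ (px-p ∘ Pm)  ≡⟨ sym assoc ⟩
          (x ∘ px-p) ∘ Pm  ≡⟨ cong (_∘ Pm) px-fp ⟩
          ρ x ∘ Pm         ≡⟨ Pmap-ρ p₂ x p₁ f commute ⟩
          f ∘ ρ p₂         ∎
        U = isPullback (px-p ∘ Pm) (ρ p₂) eqU
        p' : Hom (P p₂) apex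
        p' = proj₁ U
        V = isPullback p₁ p₂ commute
        e₁ : p₁ ∘ (p' ∘ lam p₂) ≡ p₁
        e₁ = begin
          p₁ ∘ (p' ∘ lam p₂)         ≡⟨ sym assoc ⟩
          (p₁ ∘ p') ∘ lam p₂         ≡⟨ cong (_∘ lam p₂) (proj₁ (proj₂ U)) ⟩
          (px-p ∘ Pm) ∘ lam p₂       ≡⟨ assoc ⟩
          px-p ∘ (Pm ∘ lam p₂)       ≡⟨ cong (px-p ∘_) (Pmap-lam p₂ x p₁ f commute) ⟩
          px-p ∘ (lam x ∘ p₁)        ≡⟨ sym assoc ⟩
          (px-p ∘ lam x) ∘ p₁        ≡⟨ cong (_∘ p₁) px-lam ⟩
          id ∘ p₁                    ≡⟨ identityˡ ⟩
          p₁                         ∎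
        e₂ : p₂ ∘ (p' ∘ lam p₂) ≡ p₂
        e₂ = begin
          p₂ ∘ (p' ∘ lam p₂)   ≡⟨ sym assoc ⟩
          (p₂ ∘ p') ∘ lam p₂   ≡⟨ cong (_∘ lam p₂) (proj₁ (proj₂ (proj₂ U))) ⟩
          ρ p₂ ∘ lam p₂        ≡⟨ factorises p₂ ⟩
          p₂                   ∎
        p'-lam : p' ∘ lam p₂ ≡ id
        p'-lam = trans (proj₂ (proj₂ (proj₂ V)) (p' ∘ lam p₂) e₁ e₂)
                       (sym (proj₂ (proj₂ (proj₂ V)) id identityʳ identityʳ))

    substR : ∀ {Γ Δ} → RType Γ → Hom Δ Γ → RType Δ
    substR (rtype X x px) f =
      rtype (Pullback.apex (pullback x f)) (Pullback.p₂ (pullback x f)) (pullbackRStr x px f)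

    RMapTypeCat : TypeCat (o ⊔ ℓ)
    RMapTypeCat = record
      { Ty = RType
      ; ext = RType.dom
      ; π = RType.map
      ; _[_] = substR
      ; q = λ { f (rtype X x px) → Pullback.p₁ (pullback x f) }
      ; q-comm = λ { f (rtype X x px) → Pullback.commute (pullback x f) }
      ; q-pb = λ { f (rtype X x px) → Pullback.isPullback (pullback x f) }
      }

module Submission where

-- The identity type of A = (x : X → Γ) is the cloven R-map j_x : I(x) → X ×_Γ X,
-- reflexivity is the cloven L-map i_x, and J is the chosen diagonal filler of a
-- square from the context extension Γ.A.Δ[r] into C.  For this the context
-- projection Γ.A.Δ[r] → Γ.A.A⁺.Id.Δ must be a cloven L-map, which is where the
-- Frobenius structure enters: pulling an L-map back along a type projection
-- (an R-map) gives an L-map, and iterating along a telescope Δ does the rest.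

open import Level using (Level)
open import Defs
open import Relation.Binary.PropositionalEquality using (_≡_; refl; sym; trans; cong; subst; module ≡-Reasoning)
open import Data.Product using (proj₁; proj₂)

module CategoryFacts {o ℓ : Level} (𝓔 : Category o ℓ) where
  open Category 𝓔

  pullˡ : ∀ {A B C D} {f : Hom C D} {g : Hom B C} {h : Hom B D} (z : Hom A B) →
          f ∘ g ≡ h → f ∘ (g ∘ z) ≡ h ∘ z
  pullˡ z e = trans (sym assoc) (cong (_∘ z) e)

  pullʳ : ∀ {A B C D} {g : Hom B C} {z : Hom A B} {h : Hom A C} (f : Hom C D) →
          g ∘ z ≡ h → (f ∘ g) ∘ z ≡ f ∘ h
  pullʳ f e = trans assoc (cong (f ∘_) e)

  paste : ∀ {U V X Y X' Y'} {f : Hom U V} {g : Hom X Y} {g' : Hom X' Y'}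
          {h : Hom U X} {k : Hom V Y} {h' : Hom X X'} {k' : Hom Y Y'} →
          g ∘ h ≡ k ∘ f → g' ∘ h' ≡ k' ∘ g → g' ∘ (h' ∘ h) ≡ (k' ∘ k) ∘ f
  paste {h = h} {k} {k' = k'} e e' = trans (pullˡ h e') (trans (pullʳ k' e) (sym assoc))

  pullback-jointly-monic :
    ∀ {P A B C} {f : Hom A C} {g : Hom B C} {p₁ : Hom P A} {p₂ : Hom P B} →
    f ∘ p₁ ≡ g ∘ p₂ → IsPullback 𝓔 f g p₁ p₂ →
    ∀ {V} (u v : Hom V P) → p₁ ∘ u ≡ p₁ ∘ v → p₂ ∘ u ≡ p₂ ∘ v → u ≡ v
  pullback-jointly-monic {f = f} {g} {p₁} {p₂} comm isPB u v e₁ e₂ =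
    trans (unique u e₁ e₂) (sym (unique v refl refl))
    where
      cone : f ∘ (p₁ ∘ v) ≡ g ∘ (p₂ ∘ v)
      cone = trans (pullˡ v comm) assoc
      unique = proj₂ (proj₂ (proj₂ (isPB (p₁ ∘ v) (p₂ ∘ v) cone)))

  mediator-irrelevant :
    ∀ {P A B C} {f : Hom A C} {g : Hom B C} {p₁ : Hom P A} {p₂ : Hom P B}
    (isPB : IsPullback 𝓔 f g p₁ p₂) {V} (a : Hom V A) (b : Hom V B) (e e' : f ∘ a ≡ g ∘ b) →
    proj₁ (isPB a b e) ≡ proj₁ (isPB a b e')
  mediator-irrelevant isPB a b e e' = cong (λ c → proj₁ (isPB a b c)) (Hom-isSet e e')

  module SwapPullback {A B C} {f : Hom A C} {g : Hom B C}
                      (P : Pullback 𝓔 f g) (Q : Pullback 𝓔 g f) where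
    private
      module P = Pullback P
      module Q = Pullback Q
      toP-univ = P.isPullback Q.p₂ Q.p₁ (sym Q.commute)
      toQ-univ = Q.isPullback P.p₂ P.p₁ (sym P.commute)

    toP : Hom Q.apex P.apex
    toP = proj₁ toP-univ

    toQ : Hom P.apex Q.apex
    toQ = proj₁ toQ-univ

    toP-p₁ : P.p₁ ∘ toP ≡ Q.p₂
    toP-p₁ = proj₁ (proj₂ toP-univ)

    toP-p₂ : P.p₂ ∘ toP ≡ Q.p₁
    toP-p₂ = proj₁ (proj₂ (proj₂ toP-univ))

    toP-section : toP ∘ toQ ≡ id
    toP-section = pullback-jointly-monic P.commute P.isPullback (toP ∘ toQ) id
      (trans (pullˡ toQ toP-p₁) (trans (proj₁ (proj₂ (proj₂ toQ-univ))) (sym identityʳ)))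
      (trans (pullˡ toQ toP-p₂) (trans (proj₁ (proj₂ toQ-univ)) (sym identityʳ)))

module TelescopeFacts {o ℓ t : Level} (𝓔 : Category o ℓ) (T : TypeCat 𝓔 t) where
  open Category 𝓔
  open TypeCat T

  pairT-proj : ∀ {Z W V} (c : Hom W Z) (Θ : Tele 𝓔 T Z) (x : Hom V W) (y : Hom V (ctx 𝓔 T Θ))
               (e : projT 𝓔 T Θ ∘ y ≡ c ∘ x) →
               projT 𝓔 T (substT 𝓔 T c Θ) ∘ pairT 𝓔 T c Θ x y e ≡ x
  pairT-proj c [] x y e = identityˡ
  pairT-proj c (B ∷ Θ) x y e =
    trans assoc (trans (cong (π (B [ c ]) ∘_) (pairT-proj (q c B) Θ x₁ y e₁)) (proj₁ (proj₂ (proj₂ U))))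
    where
      U = q-pb c B (projT 𝓔 T Θ ∘ y) x (trans (sym assoc) e)
      x₁ = proj₁ U
      e₁ = sym (proj₁ (proj₂ U))

module Lifting {o ℓ : Level} (𝓔 : Category o ℓ) (W : ClovenWFS 𝓔) where
  open Category 𝓔
  open ClovenWFS W
  open CategoryFacts 𝓔
  open ≡-Reasoning

  LS : ∀ {X Y} → Hom X Y → Set ℓ
  LS = LStr 𝓔 W

  RS : ∀ {X Y} → Hom X Y → Set ℓ
  RS = RStr 𝓔 W

  -- functoriality of P, for a composite square presented up to equality
  Pmap-comp : ∀ {U V X Y X' Y'} {f : Hom U V} {g : Hom X Y} {g' : Hom X' Y'}
              {h : Hom U X} {k : Hom V Y} {h' : Hom X X'} {k' : Hom Y Y'} {H : Hom U X'} {K : Hom V Y'}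
              (e : g ∘ h ≡ k ∘ f) (e' : g' ∘ h' ≡ k' ∘ g) (E : g' ∘ H ≡ K ∘ f) →
              H ≡ h' ∘ h → K ≡ k' ∘ k → Pmap g g' h' k' e' ∘ Pmap f g h k e ≡ Pmap f g' H K E
  Pmap-comp {f = f} {g} {g'} {h} {k} {h'} {k'} e e' E refl refl = sym (Pmap-∘ f g g' h k h' k' e e' E)

  Pmap-natural : ∀ {A B X Y A' B' X' Y'} {i : Hom A B} {c : Hom X Y} {i' : Hom A' B'} {c' : Hom X' Y'}
                 {a : Hom A' A} {b : Hom B' B} (eab : i ∘ a ≡ b ∘ i')
                 {u : Hom X' X} {v : Hom Y' Y} (euv : c ∘ u ≡ v ∘ c')
                 {d : Hom A X} {k : Hom B Y} (e : c ∘ d ≡ k ∘ i)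
                 {d' : Hom A' X'} {k' : Hom B' Y'} (e' : c' ∘ d' ≡ k' ∘ i') →
                 d ∘ a ≡ u ∘ d' → k ∘ b ≡ v ∘ k' →
                 Pmap c' c u v euv ∘ Pmap i' c' d' k' e' ≡ Pmap i c d k e ∘ Pmap i' i a b eab
  Pmap-natural eab euv e e' hd hk =
    trans (Pmap-comp e' euv (paste eab e) hd hk) (sym (Pmap-comp eab e (paste eab e) refl refl))

  IsLMor-cong : ∀ {U V X Y} {f : Hom U V} {g : Hom X Y} {s : LS f} {t : LS g}
                {h h' : Hom U X} {k k' : Hom V Y} (e : g ∘ h ≡ k ∘ f) (e' : g ∘ h' ≡ k' ∘ f) →
                h ≡ h' → k ≡ k' → IsLMor 𝓔 W s t h k e → IsLMor 𝓔 W s t h' k' e'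
  IsLMor-cong {s = s} {t} {h} {k = k} e e' refl refl = subst (IsLMor 𝓔 W s t h k) (Hom-isSet e e')

  fill : ∀ {A B X Y} {i : Hom A B} {c : Hom X Y} → LS i → RS c →
         (d : Hom A X) (k : Hom B Y) → c ∘ d ≡ k ∘ i → Hom B X
  fill {i = i} {c} s r d k e = RStr.p r ∘ (Pmap i c d k e ∘ LStr.s s)

  fill-top : ∀ {A B X Y} {i : Hom A B} {c : Hom X Y} (s : LS i) (r : RS c)
             (d : Hom A X) (k : Hom B Y) (e : c ∘ d ≡ k ∘ i) → fill s r d k e ∘ i ≡ d
  fill-top {i = i} {c} s r d k e = begin
    (RStr.p r ∘ (Pm ∘ LStr.s s)) ∘ i  ≡⟨ pullʳ (RStr.p r) (pullʳ Pm (LStr.s-f s)) ⟩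
    RStr.p r ∘ (Pm ∘ lam i)           ≡⟨ cong (RStr.p r ∘_) (Pmap-lam i c d k e) ⟩
    RStr.p r ∘ (lam c ∘ d)            ≡⟨ pullˡ d (RStr.p-lam r) ⟩
    id ∘ d                            ≡⟨ identityˡ ⟩
    d                                 ∎
    where Pm = Pmap i c d k e

  fill-bot : ∀ {A B X Y} {i : Hom A B} {c : Hom X Y} (s : LS i) (r : RS c)
             (d : Hom A X) (k : Hom B Y) (e : c ∘ d ≡ k ∘ i) → c ∘ fill s r d k e ≡ k
  fill-bot {i = i} {c} s r d k e = begin
    c ∘ (RStr.p r ∘ (Pm ∘ LStr.s s))  ≡⟨ pullˡ _ (RStr.f-p r) ⟩
    ρ c ∘ (Pm ∘ LStr.s s)             ≡⟨ pullˡ _ (Pmap-ρ i c d k e) ⟩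
    (k ∘ ρ i) ∘ LStr.s s              ≡⟨ pullʳ k (LStr.ρ-s s) ⟩
    k ∘ id                            ≡⟨ identityʳ ⟩
    k                                 ∎
    where Pm = Pmap i c d k e

  fill-natural :
    ∀ {A B X Y A' B' X' Y'} {i : Hom A B} {c : Hom X Y} {i' : Hom A' B'} {c' : Hom X' Y'}
    (s : LS i) (r : RS c) (s' : LS i') (r' : RS c')
    {a : Hom A' A} {b : Hom B' B} (eab : i ∘ a ≡ b ∘ i') → IsLMor 𝓔 W s' s a b eab →
    {u : Hom X' X} {v : Hom Y' Y} (euv : c ∘ u ≡ v ∘ c') → IsRMor 𝓔 W r' r u v euv →
    {d : Hom A X} {k : Hom B Y} (e : c ∘ d ≡ k ∘ i)
    {d' : Hom A' X'} {k' : Hom B' Y'} (e' : c' ∘ d' ≡ k' ∘ i') →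
    d ∘ a ≡ u ∘ d' → k ∘ b ≡ v ∘ k' → u ∘ fill s' r' d' k' e' ≡ fill s r d k e ∘ b
  fill-natural {i = i} {c} {i'} {c'} s r s' r' {a} {b} eab lm {u} {v} euv rm {d} {k} e {d'} {k'} e' hd hk =
    begin
      u ∘ (p' ∘ (Pm' ∘ LStr.s s'))   ≡⟨ sym assoc ⟩
      (u ∘ p') ∘ (Pm' ∘ LStr.s s')   ≡⟨ cong (_∘ (Pm' ∘ LStr.s s')) (sym rm) ⟩
      (p ∘ Pu) ∘ (Pm' ∘ LStr.s s')   ≡⟨ pullʳ p (sym assoc) ⟩
      p ∘ ((Pu ∘ Pm') ∘ LStr.s s')   ≡⟨ cong (λ z → p ∘ (z ∘ LStr.s s')) (Pmap-natural eab euv e e' hd hk) ⟩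
      p ∘ ((Pm ∘ Pa) ∘ LStr.s s')    ≡⟨ cong (p ∘_) (pullʳ Pm lm) ⟩
      p ∘ (Pm ∘ (LStr.s s ∘ b))      ≡⟨ cong (p ∘_) (sym assoc) ⟩
      p ∘ ((Pm ∘ LStr.s s) ∘ b)      ≡⟨ sym assoc ⟩
      (p ∘ (Pm ∘ LStr.s s)) ∘ b      ∎
    where
      p = RStr.p r
      p' = RStr.p r'
      Pm = Pmap i c d k e
      Pm' = Pmap i' c' d' k' e'
      Pu = Pmap c' c u v euv
      Pa = Pmap i' i a b eab

  over-square : ∀ {X X' Y} {i : Hom X Y} {i' : Hom X' Y} {ψ : Hom X X'} →
                i' ∘ ψ ≡ i → i' ∘ ψ ≡ id ∘ i
  over-square over = trans over (sym identityˡ)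

  transferL : ∀ {X X' Y} {i : Hom X Y} {i' : Hom X' Y} → LS i →
              (ψ : Hom X X') (φ : Hom X' X) → i' ∘ ψ ≡ i → ψ ∘ φ ≡ id → LS i'
  transferL {i = i} {i'} s ψ φ over section =
    record { s = Pm ∘ LStr.s s ; s-f = s-f ; ρ-s = ρ-s }
    where
      Pm = Pmap i i' ψ id (over-square over)
      i'≡iφ : i' ≡ i ∘ φ
      i'≡iφ = begin
        i'             ≡⟨ sym identityʳ ⟩
        i' ∘ id        ≡⟨ cong (i' ∘_) (sym section) ⟩
        i' ∘ (ψ ∘ φ)   ≡⟨ pullˡ φ over ⟩
        i ∘ φ          ∎
      s-f : (Pm ∘ LStr.s s) ∘ i' ≡ lam i'
      s-f = begin
        (Pm ∘ LStr.s s) ∘ i'        ≡⟨ cong ((Pm ∘ LStr.s s) ∘_) i'≡iφ ⟩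
        (Pm ∘ LStr.s s) ∘ (i ∘ φ)   ≡⟨ pullʳ Pm (pullˡ φ (LStr.s-f s)) ⟩
        Pm ∘ (lam i ∘ φ)            ≡⟨ pullˡ φ (Pmap-lam i i' ψ id (over-square over)) ⟩
        (lam i' ∘ ψ) ∘ φ            ≡⟨ pullʳ (lam i') section ⟩
        lam i' ∘ id                 ≡⟨ identityʳ ⟩
        lam i'                      ∎
      ρ-s : ρ i' ∘ (Pm ∘ LStr.s s) ≡ id
      ρ-s = begin
        ρ i' ∘ (Pm ∘ LStr.s s)   ≡⟨ pullˡ _ (Pmap-ρ i i' ψ id (over-square over)) ⟩
        (id ∘ ρ i) ∘ LStr.s s    ≡⟨ pullʳ id (LStr.ρ-s s) ⟩
        id ∘ id                  ≡⟨ identityˡ ⟩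
        id                       ∎

  transferL-mor :
    ∀ {X₁ X₁' Y₁ X₂ X₂' Y₂} {i₁ : Hom X₁ Y₁} {i₁' : Hom X₁' Y₁} {i₂ : Hom X₂ Y₂} {i₂' : Hom X₂' Y₂}
    (s₁ : LS i₁) (ψ₁ : Hom X₁ X₁') (φ₁ : Hom X₁' X₁) (over₁ : i₁' ∘ ψ₁ ≡ i₁) (sec₁ : ψ₁ ∘ φ₁ ≡ id)
    (s₂ : LS i₂) (ψ₂ : Hom X₂ X₂') (φ₂ : Hom X₂' X₂) (over₂ : i₂' ∘ ψ₂ ≡ i₂) (sec₂ : ψ₂ ∘ φ₂ ≡ id)
    {m : Hom X₁ X₂} {a : Hom Y₁ Y₂} (em : i₂ ∘ m ≡ a ∘ i₁) → IsLMor 𝓔 W s₁ s₂ m a em →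
    {M : Hom X₁' X₂'} → M ∘ ψ₁ ≡ ψ₂ ∘ m → (eM : i₂' ∘ M ≡ a ∘ i₁') →
    IsLMor 𝓔 W (transferL s₁ ψ₁ φ₁ over₁ sec₁) (transferL s₂ ψ₂ φ₂ over₂ sec₂) M a eM
  transferL-mor {i₁ = i₁} {i₁'} {i₂} {i₂'} s₁ ψ₁ φ₁ over₁ sec₁ s₂ ψ₂ φ₂ over₂ sec₂ {m} {a} em lm {M} hM eM =
    begin
      PM ∘ (P₁ ∘ LStr.s s₁)                            ≡⟨ sym assoc ⟩
      (PM ∘ P₁) ∘ LStr.s s₁                            ≡⟨ cong (_∘ LStr.s s₁) (Pmap-comp sq₁ eM E (sym hM) (trans identityˡ (sym identityʳ))) ⟩
      Pmap i₁ i₂' (ψ₂ ∘ m) (id ∘ a) E ∘ LStr.s s₁      ≡⟨ cong (_∘ LStr.s s₁) (sym (Pmap-comp em sq₂ E refl refl)) ⟩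
      (P₂ ∘ Pmap i₁ i₂ m a em) ∘ LStr.s s₁             ≡⟨ pullʳ P₂ lm ⟩
      P₂ ∘ (LStr.s s₂ ∘ a)                             ≡⟨ sym assoc ⟩
      (P₂ ∘ LStr.s s₂) ∘ a                             ∎
    where
      sq₁ = over-square over₁
      sq₂ = over-square over₂
      PM = Pmap i₁' i₂' M a eM
      P₁ = Pmap i₁ i₁' ψ₁ id sq₁
      P₂ = Pmap i₂ i₂' ψ₂ id sq₂
      E : i₂' ∘ (ψ₂ ∘ m) ≡ (id ∘ a) ∘ i₁
      E = paste em sq₂

module RMapTypes {o ℓ : Level} (𝓔 : Category o ℓ) (fc : FinitelyComplete 𝓔) (W : ClovenWFS 𝓔) where
  open Category 𝓔

  T : TypeCat 𝓔 _
  T = RMapTypeCat 𝓔 fc W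

  open TypeCat T public

  q-isRMor : ∀ {Γ Δ} (f : Hom Δ Γ) (A : Ty Γ) →
             IsRMor 𝓔 W (RType.str (A [ f ])) (RType.str A) (q f A) f (q-comm f A)
  q-isRMor f A = sym (proj₁ (proj₂ (Pullback.isPullback (FinitelyComplete.pullback fc (RType.map A) f) _ _ _)))

module FrobeniusTelescopes {o ℓ : Level} (𝓔 : Category o ℓ) (fc : FinitelyComplete 𝓔)
                           (W : ClovenWFS 𝓔) (FF : FunctoriallyFrobenius 𝓔 W) where
  open Category 𝓔
  open CategoryFacts 𝓔
  open Lifting 𝓔 W
  open RMapTypes 𝓔 fc W
  open ≡-Reasoning
  private
    module FC = FinitelyComplete fc
    module FR = FunctoriallyFrobenius FF

  Tel : Obj → Set _
  Tel = Tele 𝓔 T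

  Ctx : ∀ {Γ} → Tel Γ → Obj
  Ctx = ctx 𝓔 T

  -- The substitution square of B along σ compared with the Frobenius pullback
  -- of σ along the R-map π_B: both are pullbacks of the same cospan.
  module FrobeniusComparison {D G} (σ : Hom D G) (sσ : LS σ) (B : Ty G) where
    module PB = Pullback (FC.pullback (RType.map B) σ)
    module F = Pullback (FR.pb (RType.map B) (RType.str B) σ sσ)
    open SwapPullback (FC.pullback (RType.map B) σ) (FR.pb (RType.map B) (RType.str B) σ sσ) public

  -- q σ B is the pullback of the L-map σ along the R-map π_B, hence an L-map
  qL : ∀ {D G} (σ : Hom D G) → LS σ → (B : Ty G) → LS (q σ B)
  qL σ sσ B = transferL (FR.frob (RType.map B) (RType.str B) σ sσ) toP toQ toP-p₁ toP-section
    where open FrobeniusComparison σ sσ B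

  qL-mor : ∀ {D G D' G'} {σ : Hom D G} {σ' : Hom D' G'} (sσ : LS σ) (sσ' : LS σ')
           {a : Hom D' D} {b : Hom G' G} (eab : σ ∘ a ≡ b ∘ σ') → IsLMor 𝓔 W sσ' sσ a b eab →
           (B : Ty G) (m : Hom (ext ((B [ b ]) [ σ' ])) (ext (B [ σ ])))
           (hm : q σ B ∘ m ≡ q b B ∘ q σ' (B [ b ])) → π (B [ σ ]) ∘ m ≡ a ∘ π ((B [ b ]) [ σ' ]) →
           IsLMor 𝓔 W (qL σ' sσ' (B [ b ])) (qL σ sσ B) m (q b B) hm
  qL-mor {σ = σ} {σ'} sσ sσ' {a} {b} eab lm B m hm hπ =
    transferL-mor (FR.frob x' px' σ' sσ') S'.toP S'.toQ S'.toP-p₁ S'.toP-section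
                  (FR.frob x px σ sσ) S.toP S.toQ S.toP-p₁ S.toP-section
                  mF₂ frobMor m∘toP' hm
    where
      x = RType.map B
      px = RType.str B
      x' = RType.map (B [ b ])
      px' = RType.str (B [ b ])
      module S = FrobeniusComparison σ sσ B
      module S' = FrobeniusComparison σ' sσ' (B [ b ])
      cone : σ ∘ (a ∘ S'.F.p₁) ≡ x ∘ (q b B ∘ S'.F.p₂)
      cone = begin
        σ ∘ (a ∘ S'.F.p₁)       ≡⟨ pullˡ _ eab ⟩
        (b ∘ σ') ∘ S'.F.p₁      ≡⟨ pullʳ b S'.F.commute ⟩
        b ∘ (x' ∘ S'.F.p₂)      ≡⟨ sym (trans (pullˡ _ (q-comm b B)) assoc) ⟩
        x ∘ (q b B ∘ S'.F.p₂)   ∎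
      mF-univ = S.F.isPullback (a ∘ S'.F.p₁) (q b B ∘ S'.F.p₂) cone
      mF = proj₁ mF-univ
      mF₁ : S.F.p₁ ∘ mF ≡ a ∘ S'.F.p₁
      mF₁ = proj₁ (proj₂ mF-univ)
      mF₂ : S.F.p₂ ∘ mF ≡ q b B ∘ S'.F.p₂
      mF₂ = proj₁ (proj₂ (proj₂ mF-univ))
      frobMor : IsLMor 𝓔 W (FR.frob x' px' σ' sσ') (FR.frob x px σ sσ) mF (q b B) mF₂
      frobMor = FR.frob-mor x' px' σ' sσ' x px σ sσ (q b B) a b (q-comm b B) (q-isRMor b B)
                            eab lm mF mF₁ mF₂
      m∘toP' : m ∘ S'.toP ≡ S.toP ∘ mF
      m∘toP' = pullback-jointly-monic S.PB.commute S.PB.isPullback (m ∘ S'.toP) (S.toP ∘ mF)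
        (trans (pullˡ S'.toP hm) (trans (pullʳ (q b B) S'.toP-p₁) (sym (trans (pullˡ mF S.toP-p₁) mF₂))))
        (trans (pullˡ S'.toP hπ) (trans (pullʳ a S'.toP-p₂) (sym (trans (pullˡ mF S.toP-p₂) mF₁))))

  teleL : ∀ {D G} (σ : Hom D G) → LS σ → (Θ : Tel G) → LS (liftT 𝓔 T σ Θ)
  teleL σ sσ [] = sσ
  teleL σ sσ (B ∷ Θ) = teleL (q σ B) (qL σ sσ B) Θ

  teleL-mor :
    ∀ {D G D' G'} {σ : Hom D G} {σ' : Hom D' G'} (sσ : LS σ) (sσ' : LS σ')
    {a : Hom D' D} {b : Hom G' G} (eab : σ ∘ a ≡ b ∘ σ') → IsLMor 𝓔 W sσ' sσ a b eab →
    (Θ : Tel G) (m : Hom (Ctx (substT 𝓔 T σ' (substT 𝓔 T b Θ))) (Ctx (substT 𝓔 T σ Θ)))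
    (hm : liftT 𝓔 T σ Θ ∘ m ≡ liftT 𝓔 T b Θ ∘ liftT 𝓔 T σ' (substT 𝓔 T b Θ)) →
    projT 𝓔 T (substT 𝓔 T σ Θ) ∘ m ≡ a ∘ projT 𝓔 T (substT 𝓔 T σ' (substT 𝓔 T b Θ)) →
    IsLMor 𝓔 W (teleL σ' sσ' (substT 𝓔 T b Θ)) (teleL σ sσ Θ) m (liftT 𝓔 T b Θ) hm
  teleL-mor sσ sσ' {a} eab lm [] m hm hπ = IsLMor-cong {s = sσ'} {t = sσ} eab hm a≡m refl lm
    where
      a≡m : a ≡ m
      a≡m = trans (sym identityʳ) (trans (sym hπ) identityˡ)
  teleL-mor {σ = σ} {σ'} sσ sσ' {a} {b} eab lm (B ∷ Θ) m hm hπ =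
    teleL-mor (qL σ sσ B) (qL σ' sσ' (B [ b ])) a₁-q a₁-lmor Θ m hm hπ₁
    where
      σ₁' = q σ' (B [ b ])
      Θb = substT 𝓔 T (q b B) Θ
      Rest = substT 𝓔 T σ₁' Θb
      Θσ = substT 𝓔 T (q σ B) Θ
      a₁-cone : π B ∘ (q b B ∘ σ₁') ≡ σ ∘ (a ∘ π ((B [ b ]) [ σ' ]))
      a₁-cone = begin
        π B ∘ (q b B ∘ σ₁')               ≡⟨ pullˡ _ (q-comm b B) ⟩
        (b ∘ π (B [ b ])) ∘ σ₁'           ≡⟨ pullʳ b (q-comm σ' (B [ b ])) ⟩
        b ∘ (σ' ∘ π ((B [ b ]) [ σ' ]))   ≡⟨ sym (trans (pullˡ _ eab) assoc) ⟩
        σ ∘ (a ∘ π ((B [ b ]) [ σ' ]))    ∎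
      a₁-univ = q-pb σ B (q b B ∘ σ₁') (a ∘ π ((B [ b ]) [ σ' ])) a₁-cone
      a₁ = proj₁ a₁-univ
      a₁-q : q σ B ∘ a₁ ≡ q b B ∘ σ₁'
      a₁-q = proj₁ (proj₂ a₁-univ)
      a₁-π : π (B [ σ ]) ∘ a₁ ≡ a ∘ π ((B [ b ]) [ σ' ])
      a₁-π = proj₁ (proj₂ (proj₂ a₁-univ))
      a₁-lmor = qL-mor sσ sσ' eab lm B a₁ a₁-q a₁-π
      over-q : q σ B ∘ (projT 𝓔 T Θσ ∘ m) ≡ q σ B ∘ (a₁ ∘ projT 𝓔 T Rest)
      over-q = begin
        q σ B ∘ (projT 𝓔 T Θσ ∘ m)                               ≡⟨ pullˡ m (sym (liftT-proj 𝓔 T (q σ B) Θ)) ⟩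
        (projT 𝓔 T Θ ∘ liftT 𝓔 T (q σ B) Θ) ∘ m                  ≡⟨ pullʳ (projT 𝓔 T Θ) hm ⟩
        projT 𝓔 T Θ ∘ (liftT 𝓔 T (q b B) Θ ∘ liftT 𝓔 T σ₁' Θb)  ≡⟨ pullˡ _ (liftT-proj 𝓔 T (q b B) Θ) ⟩
        (q b B ∘ projT 𝓔 T Θb) ∘ liftT 𝓔 T σ₁' Θb               ≡⟨ pullʳ (q b B) (liftT-proj 𝓔 T σ₁' Θb) ⟩
        q b B ∘ (σ₁' ∘ projT 𝓔 T Rest)                          ≡⟨ sym (trans (pullˡ _ a₁-q) assoc) ⟩
        q σ B ∘ (a₁ ∘ projT 𝓔 T Rest)                           ∎
      over-π : π (B [ σ ]) ∘ (projT 𝓔 T Θσ ∘ m) ≡ π (B [ σ ]) ∘ (a₁ ∘ projT 𝓔 T Rest)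
      over-π = begin
        π (B [ σ ]) ∘ (projT 𝓔 T Θσ ∘ m)             ≡⟨ sym assoc ⟩
        (π (B [ σ ]) ∘ projT 𝓔 T Θσ) ∘ m             ≡⟨ hπ ⟩
        a ∘ (π ((B [ b ]) [ σ' ]) ∘ projT 𝓔 T Rest)  ≡⟨ sym (trans (pullˡ _ a₁-π) assoc) ⟩
        π (B [ σ ]) ∘ (a₁ ∘ projT 𝓔 T Rest)          ∎
      hπ₁ : projT 𝓔 T Θσ ∘ m ≡ a₁ ∘ projT 𝓔 T Rest
      hπ₁ = pullback-jointly-monic (q-comm σ B) (q-pb σ B) _ _ over-q over-π

module IdentityTypes {o ℓ : Level} (𝓔 : Category o ℓ) (fc : FinitelyComplete 𝓔) (W : ClovenWFS 𝓔)
                     (FF : FunctoriallyFrobenius 𝓔 W) (SD : StableFunctorialDiagonals 𝓔 W fc) where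
  open Category 𝓔
  open CategoryFacts 𝓔
  open Lifting 𝓔 W
  open RMapTypes 𝓔 fc W
  open FrobeniusTelescopes 𝓔 fc W FF
  open TelescopeFacts 𝓔 T
  private
    module FC = FinitelyComplete fc
    module SD = StableFunctorialDiagonals SD

  Id : ∀ {Γ} (A : Ty Γ) → Ty (ext (_⁺ 𝓔 T A))
  Id A = rtype (SD.I (RType.map A) (RType.str A)) (SD.j (RType.map A) (RType.str A))
               (SD.jR (RType.map A) (RType.str A))

  r : ∀ {Γ} (A : Ty Γ) → Hom (ext A) (ext (Id A))
  r A = SD.i (RType.map A) (RType.str A)

  rL : ∀ {Γ} (A : Ty Γ) → LS (r A)
  rL A = SD.iL (RType.map A) (RType.str A)

  J : ∀ {Γ} (A : Ty Γ) (Θ : Tel (ext (Id A))) (C : Ty (Ctx Θ))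
      (d : Hom (Ctx (substT 𝓔 T (r A) Θ)) (ext C)) → π C ∘ d ≡ liftT 𝓔 T (r A) Θ → Hom (Ctx Θ) (ext C)
  J A Θ C d e = fill (teleL (r A) (rL A) Θ) (RType.str C) d id (trans e (sym identityˡ))

  f⁺⁺⁺ : ∀ {Γ Δ} (f : Hom Δ Γ) (A : Ty Γ) → Hom (ext (Id (A [ f ]))) (ext (Id A))
  f⁺⁺⁺ f A = SD.Imap (RType.map (A [ f ])) (RType.str (A [ f ])) (RType.map A) (RType.str A)
                     (q f A) f (q-comm f A) (q-isRMor f A)

  kernMap≡f⁺⁺ : ∀ {Γ Δ} (f : Hom Δ Γ) (A : Ty Γ) →
                kernMap 𝓔 W fc (RType.map (A [ f ])) (RType.map A) (q f A) f (q-comm f A) ≡ f⁺⁺ 𝓔 T f A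
  kernMap≡f⁺⁺ f A = mediator-irrelevant (Pullback.isPullback (FC.pullback (RType.map A) (RType.map A))) _ _ _ _

  f⁺⁺⁺-comm : ∀ {Γ Δ} (f : Hom Δ Γ) (A : Ty Γ) → π (Id A) ∘ f⁺⁺⁺ f A ≡ f⁺⁺ 𝓔 T f A ∘ π (Id (A [ f ]))
  f⁺⁺⁺-comm f A =
    trans (SD.Imap-sqR (RType.map (A [ f ])) (RType.str (A [ f ])) (RType.map A) (RType.str A)
                       (q f A) f (q-comm f A) (q-isRMor f A))
          (cong (_∘ π (Id (A [ f ]))) (kernMap≡f⁺⁺ f A))

  f⁺⁺⁺-pb : ∀ {Γ Δ} (f : Hom Δ Γ) (A : Ty Γ) →
            IsPullback 𝓔 (π (Id A)) (f⁺⁺ 𝓔 T f A) (f⁺⁺⁺ f A) (π (Id (A [ f ])))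
  f⁺⁺⁺-pb f A =
    subst (λ k → IsPullback 𝓔 (π (Id A)) k (f⁺⁺⁺ f A) (π (Id (A [ f ])))) (kernMap≡f⁺⁺ f A)
      (SD.stable (RType.map (A [ f ])) (RType.str (A [ f ])) (RType.map A) (RType.str A)
                 (q f A) f (q-comm f A) (q-isRMor f A) (q-pb f A))

  r-square : ∀ {Γ Δ} (f : Hom Δ Γ) (A : Ty Γ) → r A ∘ q f A ≡ f⁺⁺⁺ f A ∘ r (A [ f ])
  r-square f A = SD.Imap-sqL (RType.map (A [ f ])) (RType.str (A [ f ])) (RType.map A) (RType.str A)
                             (q f A) f (q-comm f A) (q-isRMor f A)

  r-isLMor : ∀ {Γ Δ} (f : Hom Δ Γ) (A : Ty Γ) → IsLMor 𝓔 W (rL (A [ f ])) (rL A) (q f A) (f⁺⁺⁺ f A) (r-square f A)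
  r-isLMor f A = SD.Imap-L (RType.map (A [ f ])) (RType.str (A [ f ])) (RType.map A) (RType.str A)
                           (q f A) f (q-comm f A) (q-isRMor f A)

  idData : IdData 𝓔 T
  idData = record
    { Id = Id
    ; r = r
    ; r-π = λ A → SD.factors (RType.map A) (RType.str A)
    ; J = J
    ; J-β = λ A Θ C d e → fill-top (teleL (r A) (rL A) Θ) (RType.str C) d id (trans e (sym identityˡ))
    ; J-sec = λ A Θ C d e → fill-bot (teleL (r A) (rL A) Θ) (RType.str C) d id (trans e (sym identityˡ))
    ; f⁺⁺⁺ = f⁺⁺⁺
    ; f⁺⁺⁺-comm = f⁺⁺⁺-comm
    ; f⁺⁺⁺-pb = f⁺⁺⁺-pb
    ; r-stable = λ f A → sym (r-square f A)
    }

  compT-isLMor : ∀ {Γ Δ} (f : Hom Δ Γ) (A : Ty Γ) (Θ : Tel (ext (Id A))) →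
                 IsLMor 𝓔 W (teleL (r (A [ f ])) (rL (A [ f ])) (substT 𝓔 T (f⁺⁺⁺ f A) Θ)) (teleL (r A) (rL A) Θ)
                        (compT 𝓔 T idData f A Θ) (liftT 𝓔 T (f⁺⁺⁺ f A) Θ) (compT-lift 𝓔 T idData f A Θ)
  compT-isLMor f A Θ =
    teleL-mor (rL A) (rL (A [ f ])) (r-square f A) (r-isLMor f A) Θ
              (compT 𝓔 T idData f A Θ) (compT-lift 𝓔 T idData f A Θ) (pairT-proj (r A) Θ _ _ _)

  -- J commutes with substitution, by naturality of chosen fillers
  J-stable : JStable 𝓔 T idData
  J-stable f A Θ C d e =
    fill-natural (teleL (r A) (rL A) Θ) (RType.str C)
                 (teleL (r (A [ f ])) (rL (A [ f ])) (substT 𝓔 T g Θ)) (RType.str (C [ gΘ ]))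
                 (compT-lift 𝓔 T idData f A Θ) (compT-isLMor f A Θ)
                 (q-comm gΘ C) (q-isRMor gΘ C)
                 (trans e (sym identityˡ)) (trans (dsub-π 𝓔 T idData f A Θ C d e) (sym identityˡ))
                 (sym (proj₁ (proj₂ (dsubU 𝓔 T idData f A Θ C d e))))
                 (trans identityˡ (sym identityʳ))
    where
      g = f⁺⁺⁺ f A
      gΘ = liftT 𝓔 T g Θ

theorem3p9 : ∀ {o ℓ : Level} (𝓔 : Category o ℓ) (fc : FinitelyComplete 𝓔) (W : ClovenWFS 𝓔) →
    FunctoriallyFrobenius 𝓔 W → StableFunctorialDiagonals 𝓔 W fc →
    StrongIdTypes 𝓔 (RMapTypeCat 𝓔 fc W)
theorem3p9 𝓔 fc W FF SD = record { idData = idData ; J-stable = J-stable }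
  where open IdentityTypes 𝓔 fc W FF SD
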